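{- For every positive integer $k$, \[ \sum_{b\ge0} J(b,k,1)x^b = [z^k]\left( \frac{1}{1-z}\cdot \frac{1}{1-\sum_{i=1}^k x^{i}\sum_{j=0}^{i} z^j}\right), \] where $[z^k]F(z)$ denotes the coefficient of $z^k$ in a formal power series $F(z)$.
   Context: A composition is a finite sequence $\alpha=(\alpha_1,\dots,\alpha_s)$ of positive integers; its size is $|\alpha|=\alpha_1+\dots+\alpha_s$, and the empty sequence is the unique composition of $0$. Write $[n]=\{1,\dots,n\}$. A (multiplex juggling) card is a triple $(\alpha,\beta,f)$ where $\alpha=(\alpha_1,\dots,\alpha_s)$ and $\beta=(\beta_1,\dots,\beta_t)$ are compositions with $|\alpha|=|\beta|$, and $f:[s]\to\{0\}\cup[t]$ is a strictly increasing function such that for all $i\in[s]$, if $f(i)\neq0$ then $\alpha_i\le\beta_{f(i)}$. Here $\alpha$ is the arrival composition, $\beta$ the departure composition; the card has $|\alpha|$ balls, and has capacity $k$ if every part of $\alpha$ and of $\beta$ is at most $k$. An $\ell$-card sequence with $b$ balls and capacity $k$ is a sequence $(C_1,\dots,C_\ell)$ of cards, each with $b$ balls and capacity $k$, such that the departure composition of $C_i$ equals the arrival composition of $C_{i+1}$ for all $i\in[\ell-1]$. $J(b,k,\ell)$ denotes the number of such $\ell$-card sequences; in particular $J(b,k,1)$ is the number of cards with $b$ balls and capacity $k$. -}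

module Defs where

open import Data.Nat using (ℕ; zero; suc; _+_; _*_; _∸_; _≤_; _≤ᵇ_; _≡ᵇ_)
open import Data.Bool using (Bool; true; false; if_then_else_; _∧_)
open import Data.List using (List; length)
open import Data.Nat.ListAction using (sum)
open import Data.List.Relation.Unary.All using (All)
open import Data.Vec using (Vec)
open import Data.Fin using (Fin; zero; suc)
import Data.Fin as F
import Data.List as L
import Data.Vec as V
open import Relation.Binary.PropositionalEquality using (_≡_)

-- A composition is represented as a list of natural numbers all of which
-- are positive (checked by the field 'pos' below); its size is 'sum'.
-- The map f : [s] → {0} ∪ [t] is represented as a vector of length s with
-- entries in Fin (suc t): 'zero' encodes the value 0 and 'suc j' encodes
-- the value j+1 (i.e. the (j+1)-th part of β, which is 'lookup β j').
-- All proof fields are irrelevant, so two cards are equal iff they have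
-- the same α, β and f; hence counting cards = counting elements of 'Card'.
record Card (b k : ℕ) : Set where
  field
    α : List ℕ
    β : List ℕ
    f : Vec (Fin (suc (length β))) (length α)
    .α-pos : All (λ a → 1 ≤ a) α
    .β-pos : All (λ a → 1 ≤ a) β
    .α-size : sum α ≡ b
    .β-size : sum β ≡ b
    .α-cap : All (λ a → a ≤ k) α
    .β-cap : All (λ a → a ≤ k) β
    .f-incr : ∀ (i j : Fin (length α)) → i F.< j → V.lookup f i F.< V.lookup f j
    .f-fit : ∀ (i : Fin (length α)) (j : Fin (length β)) →
             V.lookup f i ≡ suc j → L.lookup α i ≤ L.lookup β j

-- Formal power series in two variables x, z with ℕ coefficients:
-- S a c is the coefficient of x^a z^c.

Series : Set
Series = ℕ → ℕ → ℕ

sumTo : ℕ → (ℕ → ℕ) → ℕ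
sumTo zero f = f zero
sumTo (suc n) f = sumTo n f + f (suc n)

_⊛_ : Series → Series → Series
(S ⊛ T) a c = sumTo a (λ i → sumTo c (λ j → S i j * T (a ∸ i) (c ∸ j)))

oneS : Series
oneS a c = if (a ≡ᵇ 0) ∧ (c ≡ᵇ 0) then 1 else 0

powS : Series → ℕ → Series
powS S zero = oneS
powS S (suc n) = S ⊛ powS S n

-- 1/(1 - P) = Σ_{n≥0} P^n, for a series P with no x^0 terms (so that
-- P^n only contributes to x^a with a ≥ n, and the sum is finite
-- coefficientwise).  Only applied to such P below.
geomS : Series → Series
geomS P a c = sumTo a (λ n → powS P n a c)

invOneMinusZ : Series
invOneMinusZ a c = if a ≡ᵇ 0 then 1 else 0

-- P_k = Σ_{i=1}^{k} x^i Σ_{j=0}^{i} z^j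
Pk : ℕ → Series
Pk k a c = if (1 ≤ᵇ a) ∧ (a ≤ᵇ k) ∧ (c ≤ᵇ a) then 1 else 0

rhsSeries : ℕ → Series
rhsSeries k = invOneMinusZ ⊛ geomS (Pk k)

rhsCoeff : ℕ → ℕ → ℕ
rhsCoeff k b = rhsSeries k b k

{-# OPTIONS --safe #-}
module Submission where

-- Since f is strictly increasing, only α₁ can be sent to 0. Adjoining to β a virtual first part
-- of size k to receive it, a card becomes an order-preserving embedding α ↪ k ∷ β in which every
-- part of α lands on a part at least as large (the capacity bound α₁ ≤ k is the fit condition at
-- the virtual part). Reading the target parts y in order, y contributes the monomial x^y z^(y - a),
-- where a is the part of α landing on y (a = 0 if none); as |α| = |β|, the z-degrees add up to k.
-- Forgetting the virtual part leaves a word in the monomials of P_k of x-degree b and z-degree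
-- c ≤ k, and the word determines the card: a = y - j is recovered from x^y z^j, and a = 0 is
-- distinguishable because parts of α are positive. On the series side, [x^b z^k] of
-- (1 - z)⁻¹ (1 - P_k)⁻¹ is Σ_{c ≤ k} [x^b z^c] Σ_n P_k^n, which counts exactly these words.

open import Defs
open import Data.Bool using (Bool; true; false; T; if_then_else_; _∧_)
open import Data.Bool.Properties using (T-∧)
open import Data.Empty using (⊥; ⊥-elim; ⊥-elim-irr)
open import Data.Fin using (Fin; zero; suc; toℕ)
import Data.Fin as F
open import Data.Fin.Properties using (+↔⊎)
open import Data.Irrelevant using ([_])
open import Data.List using (List; []; _∷_; length; map; drop)
import Data.List as L
open import Data.List.Membership.Propositional.Properties using (∈-lookup)
open import Data.List.Properties using (drop-map)
open import Data.List.Relation.Binary.Sublist.Heterogeneous using (Sublist; []; _∷_; _∷ʳ_)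
open import Data.List.Relation.Unary.All as All using (All; []; _∷_)
open import Data.List.Relation.Unary.All.Properties using (drop⁺; map⁺)
open import Data.Nat using (ℕ; zero; suc; _+_; _*_; _∸_; _≤_; _<_; z≤n; s≤s; z<s; s<s⁻¹; _≤ᵇ_)
open import Data.Nat.ListAction using (sum)
open import Data.Nat.Properties
open import Algebra.Properties.CommutativeSemigroup +-commutativeSemigroup using (interchange)
open import Data.Product using (Σ; _×_; _,_; proj₁; proj₂; uncurry)
open import Data.Refinement using (Refinement-syntax; _,_; value; refine; value-injective)
open import Data.Sum using (_⊎_; inj₁; inj₂)
open import Data.Sum.Function.Propositional using (_⊎-cong_)
open import Data.Vec using (Vec; []; _∷_)
import Data.Vec as V
open import Data.Vec.Properties using (lookup-map; ∷-injectiveʳ)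
open import Function using (_∘_; _⇔_; Equivalence)
open import Function.Bundles using (_↔_; mk↔ₛ′; mk⇔)
open import Function.Properties.Inverse using (↔-trans)
open import Function.Related.Propositional as Related using ()
open import Relation.Binary.Definitions using (Decidable; Irrelevant)
open import Relation.Binary.PropositionalEquality
open import Relation.Nullary using (yes; no)
open import Relation.Nullary.Decidable using (recompute)

private variable
  g : ℕ → ℕ → Bool
  a b c i j k m n : ℕ
  l : List (ℕ × ℕ)

-- Finite sums and counting

sumTo-cong : ∀ n {f h : ℕ → ℕ} → (∀ i → f i ≡ h i) → sumTo n f ≡ sumTo n h
sumTo-cong zero    f≗h = f≗h 0
sumTo-cong (suc n) f≗h = cong₂ _+_ (sumTo-cong n f≗h) (f≗h (suc n))

sumTo-suc : ∀ n (f : ℕ → ℕ) → sumTo (suc n) f ≡ f 0 + sumTo n (f ∘ suc)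
sumTo-suc zero    f = refl
sumTo-suc (suc n) f = trans (cong (_+ f (suc (suc n))) (sumTo-suc n f))
                            (+-assoc (f 0) (sumTo n (f ∘ suc)) (f (suc (suc n))))

sumTo-reverse : ∀ n (f : ℕ → ℕ) → sumTo n (λ j → f (n ∸ j)) ≡ sumTo n f
sumTo-reverse zero    f = refl
sumTo-reverse (suc n) f = begin
  sumTo (suc n) (λ j → f (suc n ∸ j))   ≡⟨ sumTo-suc n (λ j → f (suc n ∸ j)) ⟩
  f (suc n) + sumTo n (λ j → f (n ∸ j)) ≡⟨ cong (f (suc n) +_) (sumTo-reverse n f) ⟩
  f (suc n) + sumTo n f                 ≡⟨ +-comm (f (suc n)) (sumTo n f) ⟩
  sumTo (suc n) f                       ∎
  where open ≡-Reasoning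

sumTo-zero : ∀ n → sumTo n (λ _ → 0) ≡ 0
sumTo-zero zero    = refl
sumTo-zero (suc n) = cong (_+ 0) (sumTo-zero n)

sumTo-head : ∀ n (f : ℕ → ℕ) → (∀ i → f (suc i) ≡ 0) → sumTo n f ≡ f 0
sumTo-head zero    f tail≡0 = refl
sumTo-head (suc n) f tail≡0 =
  trans (cong₂ _+_ (sumTo-head n f tail≡0) (tail≡0 n)) (+-identityʳ (f 0))

invOneMinusZ-⊛ : ∀ (S : Series) a c → (invOneMinusZ ⊛ S) a c ≡ sumTo c (S a)
invOneMinusZ-⊛ S a c = begin
  (invOneMinusZ ⊛ S) a c          ≡⟨ sumTo-head a _ (λ _ → sumTo-zero c) ⟩
  sumTo c (λ j → 1 * S a (c ∸ j)) ≡⟨ sumTo-cong c (λ j → *-identityˡ (S a (c ∸ j))) ⟩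
  sumTo c (λ j → S a (c ∸ j))     ≡⟨ sumTo-reverse c (S a) ⟩
  sumTo c (S a)                   ∎
  where open ≡-Reasoning

module _ {B : ℕ → Set} where

  Σ-≤-zero : B 0 ↔ Σ [ i ∈ ℕ ∣ i ≤ 0 ] (B ∘ value)
  Σ-≤-zero = mk↔ₛ′ (λ y → (0 , [ z≤n ]) , y) from (λ { ((zero , _) , y) → refl }) (λ _ → refl)
    where
    from : Σ [ i ∈ ℕ ∣ i ≤ 0 ] (B ∘ value) → B 0
    from ((zero , _) , y) = y

  Σ-≤-suc : (B 0 ⊎ Σ [ i ∈ ℕ ∣ i ≤ n ] (B ∘ suc ∘ value)) ↔ Σ [ i ∈ ℕ ∣ i ≤ suc n ] (B ∘ value)
  Σ-≤-suc {n} = mk↔ₛ′ to from to∘from (λ { (inj₁ _) → refl ; (inj₂ _) → refl })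
    where
    to : B 0 ⊎ Σ [ i ∈ ℕ ∣ i ≤ n ] (B ∘ suc ∘ value) → Σ [ i ∈ ℕ ∣ i ≤ suc n ] (B ∘ value)
    to (inj₁ y)                   = (0 , [ z≤n ]) , y
    to (inj₂ ((i , [ i≤n ]) , y)) = (suc i , [ s≤s i≤n ]) , y

    from : Σ [ i ∈ ℕ ∣ i ≤ suc n ] (B ∘ value) → B 0 ⊎ Σ [ i ∈ ℕ ∣ i ≤ n ] (B ∘ suc ∘ value)
    from ((zero  , _) , y)         = inj₁ y
    from ((suc i , [ i<1+n ]) , y) = inj₂ ((i , [ ≤-pred i<1+n ]) , y)

    to∘from : ∀ x → to (from x) ≡ x
    to∘from ((zero  , _) , y) = refl
    to∘from ((suc i , _) , y) = refl

Fin-sumTo : ∀ n (f : ℕ → ℕ) {B : ℕ → Set} → (∀ i → Fin (f i) ↔ B i) →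
            Fin (sumTo n f) ↔ Σ [ i ∈ ℕ ∣ i ≤ n ] (B ∘ value)
Fin-sumTo zero    f e = ↔-trans (e 0) Σ-≤-zero
Fin-sumTo (suc n) f {B} e = begin
  Fin (sumTo (suc n) f)                         ≡⟨ cong Fin (sumTo-suc n f) ⟩
  Fin (f 0 + sumTo n (f ∘ suc))                 ↔⟨ +↔⊎ ⟩
  (Fin (f 0) ⊎ Fin (sumTo n (f ∘ suc)))         ↔⟨ e 0 ⊎-cong Fin-sumTo n (f ∘ suc) (e ∘ suc) ⟩
  (B 0 ⊎ Σ [ i ∈ ℕ ∣ i ≤ n ] (B ∘ suc ∘ value)) ↔⟨ Σ-≤-suc ⟩
  Σ [ i ∈ ℕ ∣ i ≤ suc n ] (B ∘ value)           ∎
  where open Related.EquationalReasoning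

Fin0↔∅ : ∀ {A : Set} {P : A → Set} → (∀ {x} → P x → ⊥) → Fin 0 ↔ [ x ∈ A ∣ P x ]
Fin0↔∅ ¬P = mk↔ₛ′ (λ ()) (λ { (_ , [ p ]) → ⊥-elim-irr (¬P p) }) (λ { (_ , [ p ]) → ⊥-elim-irr (¬P p) }) (λ ())

module _ {A : Set} {P : A → Set} where

  refine-↔ : ∀ {Q : A → Set} → (∀ {x} → P x → Q x) → (∀ {x} → Q x → P x) →
             [ x ∈ A ∣ P x ] ↔ [ x ∈ A ∣ Q x ]
  refine-↔ P⇒Q Q⇒P = mk↔ₛ′ (refine P⇒Q) (refine Q⇒P) (λ _ → refl) (λ _ → refl)

  Fin-if-* : ∀ t → Fin m ↔ [ x ∈ A ∣ P x ] → Fin ((if t then 1 else 0) * m) ↔ [ x ∈ A ∣ T t × P x ]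
  Fin-if-* {m} true  e = ↔-trans (Related.≡⇒ (cong Fin (+-identityʳ m))) (↔-trans e (refine-↔ (_ ,_) proj₂))
  Fin-if-*     false e = Fin0↔∅ proj₁

  Σ-fibres : ∀ m (h : A → ℕ) →
             Σ [ i ∈ ℕ ∣ i ≤ m ] (λ i → [ x ∈ A ∣ P x × h x ≡ value i ]) ↔ [ x ∈ A ∣ P x × h x ≤ m ]
  Σ-fibres m h = mk↔ₛ′ to from (λ _ → refl) from∘to
    where
    to : Σ [ i ∈ ℕ ∣ i ≤ m ] (λ i → [ x ∈ A ∣ P x × h x ≡ value i ]) → [ x ∈ A ∣ P x × h x ≤ m ]
    to ((i , [ i≤m ]) , (x , [ q ])) = x , [ proj₁ q , subst (_≤ m) (sym (proj₂ q)) i≤m ]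

    from : [ x ∈ A ∣ P x × h x ≤ m ] → Σ [ i ∈ ℕ ∣ i ≤ m ] (λ i → [ x ∈ A ∣ P x × h x ≡ value i ])
    from (x , [ q ]) = (h x , [ proj₂ q ]) , (x , [ proj₁ q , refl ])

    from∘to : ∀ y → from (to y) ≡ y
    from∘to ((i , _) , (x , [ q ])) with recompute (h x ≟ i) (proj₂ q)
    ... | refl = refl

-- Words in the monomials of a 0/1 series

xDegree zDegree : List (ℕ × ℕ) → ℕ
xDegree l = sum (map proj₁ l)
zDegree l = sum (map proj₂ l)

indicator : (ℕ → ℕ → Bool) → Series
indicator g a c = if g a c then 1 else 0

Words : (ℕ → ℕ → Bool) → ℕ → ℕ → List (ℕ × ℕ) → Set
Words g a c l = (All (T ∘ uncurry g) l × xDegree l ≡ a) × zDegree l ≡ c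

WordsOfLength : (ℕ → ℕ → Bool) → ℕ → ℕ → ℕ → Set
WordsOfLength g n a c = [ l ∈ List (ℕ × ℕ) ∣ Words g a c l × length l ≡ n ]

WordsByFirstLetter : (ℕ → ℕ → Bool) → ℕ → ℕ → ℕ → Set
WordsByFirstLetter g n a c = Σ [ i ∈ ℕ ∣ i ≤ a ] λ i → Σ [ j ∈ ℕ ∣ j ≤ c ] λ j →
  [ l ∈ List (ℕ × ℕ) ∣ T (g (value i) (value j)) × (Words g (a ∸ value i) (c ∸ value j) l × length l ≡ n) ]

+≡⇒≤×∸ : ∀ {i s m} → i + s ≡ m → i ≤ m × s ≡ m ∸ i
+≡⇒≤×∸ {i} {s} refl = m≤m+n i s , sym (m+n∸m≡n i s)

Words-∷⁺ : i ≤ a → j ≤ c → T (g i j) → Words g (a ∸ i) (c ∸ j) l → Words g a c ((i , j) ∷ l)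
Words-∷⁺ {i} {j = j} i≤a j≤c t ((ts , x≡) , z≡) =
  (t ∷ ts , trans (cong (i +_) x≡) (m+[n∸m]≡n i≤a)) , trans (cong (j +_) z≡) (m+[n∸m]≡n j≤c)

Words-∷⁻ : Words g a c ((i , j) ∷ l) → (i ≤ a × j ≤ c) × T (g i j) × Words g (a ∸ i) (c ∸ j) l
Words-∷⁻ ((t ∷ ts , x≡) , z≡) =
  (proj₁ (+≡⇒≤×∸ x≡) , proj₁ (+≡⇒≤×∸ z≡)) , t , (ts , proj₂ (+≡⇒≤×∸ x≡)) , proj₂ (+≡⇒≤×∸ z≡)

WordsByFirstLetter↔WordsOfLength : ∀ g n a c → WordsByFirstLetter g n a c ↔ WordsOfLength g (suc n) a c
WordsByFirstLetter↔WordsOfLength g n a c = mk↔ₛ′ to from to∘from (λ _ → refl)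
  where
  to : WordsByFirstLetter g n a c → WordsOfLength g (suc n) a c
  to ((i , [ i≤a ]) , (j , [ j≤c ]) , (l , [ q ])) =
    (i , j) ∷ l , [ Words-∷⁺ i≤a j≤c (proj₁ q) (proj₁ (proj₂ q)) , cong suc (proj₂ (proj₂ q)) ]

  from : WordsOfLength g (suc n) a c → WordsByFirstLetter g n a c
  from ([] , [ q ]) = ⊥-elim-irr (0≢1+n (proj₂ q))
  from ((i , j) ∷ l , [ q ]) =
    (i , [ proj₁ (proj₁ (Words-∷⁻ (proj₁ q))) ]) , (j , [ proj₂ (proj₁ (Words-∷⁻ (proj₁ q))) ]) ,
    (l , [ proj₁ (proj₂ (Words-∷⁻ (proj₁ q))) , proj₂ (proj₂ (Words-∷⁻ (proj₁ q))) , suc-injective (proj₂ q) ])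

  to∘from : ∀ w → to (from w) ≡ w
  to∘from ([] , [ q ])  = ⊥-elim-irr (0≢1+n (proj₂ q))
  to∘from ((_ ∷ _) , _) = refl

Fin-powS : ∀ g n a c → Fin (powS (indicator g) n a c) ↔ WordsOfLength g n a c
Fin-powS g zero zero zero = mk↔ₛ′ (λ _ → emptyWord) (λ _ → zero) to∘from (λ { zero → refl })
  where
  emptyWord : WordsOfLength g 0 0 0
  emptyWord = [] , [ (([] , refl) , refl) , refl ]

  to∘from : ∀ w → emptyWord ≡ w
  to∘from ([] , _)        = refl
  to∘from (_ ∷ _ , [ q ]) = ⊥-elim-irr (1+n≢0 (proj₂ q))
Fin-powS g zero (suc a) c = Fin0↔∅ no-word
  where
  no-word : Words g (suc a) c l × length l ≡ 0 → ⊥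
  no-word {[]}    (((_ , ()) , _) , _)
  no-word {_ ∷ _} (_ , ())
Fin-powS g zero zero (suc c) = Fin0↔∅ no-word
  where
  no-word : Words g 0 (suc c) l × length l ≡ 0 → ⊥
  no-word {[]}    ((_ , ()) , _)
  no-word {_ ∷ _} (_ , ())
Fin-powS g (suc n) a c =
  ↔-trans (Fin-sumTo a _ λ i → Fin-sumTo c _ λ j → Fin-if-* (g i j) (Fin-powS g n (a ∸ i) (c ∸ j)))
          (WordsByFirstLetter↔WordsOfLength g n a c)

length≤xDegree : All (λ p → 1 ≤ proj₁ p) l → length l ≤ xDegree l
length≤xDegree []         = z≤n
length≤xDegree (1≤i ∷ ps) = +-mono-≤ 1≤i (length≤xDegree ps)

Fin-geomS : ∀ g a c → (∀ {i j} → T (g i j) → 1 ≤ i) →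
            Fin (geomS (indicator g) a c) ↔ [ l ∈ List (ℕ × ℕ) ∣ Words g a c l ]
Fin-geomS g a c 1≤x = begin
  Fin (geomS (indicator g) a c)                              ↔⟨ Fin-sumTo a _ (λ n → Fin-powS g n a c) ⟩
  Σ [ n ∈ ℕ ∣ n ≤ a ] (λ n → WordsOfLength g (value n) a c) ↔⟨ Σ-fibres a length ⟩
  [ l ∈ List (ℕ × ℕ) ∣ Words g a c l × length l ≤ a ]        ↔⟨ refine-↔ proj₁ (λ w → w , length≤a w) ⟩
  [ l ∈ List (ℕ × ℕ) ∣ Words g a c l ]                       ∎
  where
  open Related.EquationalReasoning
  length≤a : Words g a c l → length l ≤ a
  length≤a ((ts , refl) , _) = length≤xDegree (All.map 1≤x ts)

Monomial : ℕ → ℕ × ℕ → Set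
Monomial k (i , j) = 1 ≤ i × i ≤ k × j ≤ i

-- Pk k is definitionally indicator (inPk k).
inPk : ℕ → ℕ → ℕ → Bool
inPk k i j = (1 ≤ᵇ i) ∧ (i ≤ᵇ k) ∧ (j ≤ᵇ i)

T-inPk : ∀ k p → T (uncurry (inPk k) p) ⇔ Monomial k p
T-inPk k (i , j) = mk⇔ to from
  where
  to : T (inPk k i j) → Monomial k (i , j)
  to t = let t₁ , t₂₃ = Equivalence.to (T-∧ {1 ≤ᵇ i}) t; t₂ , t₃ = Equivalence.to (T-∧ {i ≤ᵇ k}) t₂₃ in
         ≤ᵇ⇒≤ 1 i t₁ , ≤ᵇ⇒≤ i k t₂ , ≤ᵇ⇒≤ j i t₃

  from : Monomial k (i , j) → T (inPk k i j)
  from (1≤i , i≤k , j≤i) =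
    Equivalence.from (T-∧ {1 ≤ᵇ i}) (≤⇒≤ᵇ 1≤i , Equivalence.from (T-∧ {i ≤ᵇ k}) (≤⇒≤ᵇ i≤k , ≤⇒≤ᵇ j≤i))

MonomialList : ℕ → ℕ → List (ℕ × ℕ) → Set
MonomialList k b l = (All (Monomial k) l × xDegree l ≡ b) × zDegree l ≤ k

MonomialLists : ℕ → ℕ → Set
MonomialLists k b = [ l ∈ List (ℕ × ℕ) ∣ MonomialList k b l ]

Fin-rhsCoeff : ∀ k b → Fin (rhsCoeff k b) ↔ MonomialLists k b
Fin-rhsCoeff k b = begin
  Fin (rhsCoeff k b)
    ≡⟨ cong Fin (invOneMinusZ-⊛ (geomS (Pk k)) b k) ⟩
  Fin (sumTo k (geomS (indicator (inPk k)) b))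
    ↔⟨ Fin-sumTo k _ (λ c → Fin-geomS (inPk k) b c (λ {i} {j} → 1≤x {i} {j})) ⟩
  Σ [ c ∈ ℕ ∣ c ≤ k ] (λ c → [ l ∈ List (ℕ × ℕ) ∣ Words (inPk k) b (value c) l ])
    ↔⟨ Σ-fibres k zDegree ⟩
  [ l ∈ List (ℕ × ℕ) ∣ (All (T ∘ uncurry (inPk k)) l × xDegree l ≡ b) × zDegree l ≤ k ]
    ↔⟨ refine-↔ (λ ((ts , x≡) , z≤) → (All.map (λ {p} → Equivalence.to (T-inPk k p)) ts , x≡) , z≤)
                (λ ((ms , x≡) , z≤) → (All.map (λ {p} → Equivalence.from (T-inPk k p)) ms , x≡) , z≤) ⟩
  MonomialLists k b
    ∎
  where
  open Related.EquationalReasoning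
  1≤x : T (inPk k i j) → 1 ≤ i
  1≤x {i} {j} t = proj₁ (Equivalence.to (T-inPk k (i , j)) t)

-- Strictly increasing index vectors and sublists

record Increasing (v : Vec (Fin n) m) : Set where
  constructor increasing
  field lookup-< : ∀ i j → i F.< j → V.lookup v i F.< V.lookup v j
open Increasing

module _ {x : Fin n} {v : Vec (Fin n) m} where

  Increasing-tail : Increasing (x ∷ v) → Increasing v
  Increasing-tail inc = increasing λ i j i<j → lookup-< inc (suc i) (suc j) (s≤s i<j)

  Increasing-head : Increasing (x ∷ v) → ∀ i → x F.< V.lookup v i
  Increasing-head inc i = lookup-< inc zero (suc i) z<s

Increasing-suc∷-positive : ∀ {x : Fin n} {v : Vec (Fin (suc n)) m} → Increasing (F.suc x ∷ v) →
                           ∀ i → 0 < toℕ (V.lookup (F.suc x ∷ v) i)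
Increasing-suc∷-positive inc zero    = z<s
Increasing-suc∷-positive inc (suc i) = <-trans z<s (Increasing-head inc i)

module _ {v : Vec (Fin n) m} where

  Increasing-map-suc : Increasing v → Increasing (V.map F.suc v)
  Increasing-map-suc inc = increasing λ i j i<j →
    subst₂ F._<_ (sym (lookup-map i F.suc v)) (sym (lookup-map j F.suc v)) (s≤s (lookup-< inc i j i<j))

  Increasing-zero∷ : Increasing v → Increasing (F.zero ∷ V.map F.suc v)
  Increasing-zero∷ inc = increasing λ where
    zero    (suc j) _         → subst ((0 <_) ∘ toℕ) (sym (lookup-map j F.suc v)) z<s
    (suc i) (suc j) (s≤s i<j) → lookup-< (Increasing-map-suc inc) i j i<j

unsuc : (v : Vec (Fin (suc n)) m) → .(∀ i → 0 < toℕ (V.lookup v i)) → Vec (Fin n) m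
unsuc []          _   = []
unsuc (zero  ∷ v) pos = ⊥-elim-irr (n≮0 (pos F.zero))
unsuc (suc x ∷ v) pos = x ∷ unsuc v (pos ∘ F.suc)

lookup-unsuc : ∀ (v : Vec (Fin (suc n)) m) .pos i → V.lookup v i ≡ F.suc (V.lookup (unsuc v pos) i)
lookup-unsuc (zero  ∷ v) pos _       = ⊥-elim-irr (n≮0 (pos F.zero))
lookup-unsuc (suc x ∷ v) pos zero    = refl
lookup-unsuc (suc x ∷ v) pos (suc i) = lookup-unsuc v (pos ∘ F.suc) i

map-suc-unsuc : ∀ (v : Vec (Fin (suc n)) m) .pos → V.map F.suc (unsuc v pos) ≡ v
map-suc-unsuc []          _   = refl
map-suc-unsuc (zero  ∷ v) pos = ⊥-elim-irr (n≮0 (pos F.zero))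
map-suc-unsuc (suc x ∷ v) pos = cong (suc x ∷_) (map-suc-unsuc v (pos ∘ F.suc))

unsuc-map-suc : ∀ {v : Vec (Fin (suc n)) m} (w : Vec (Fin n) m) .pos → v ≡ V.map F.suc w → unsuc v pos ≡ w
unsuc-map-suc []      _   refl = refl
unsuc-map-suc (x ∷ w) pos refl = cong (x ∷_) (unsuc-map-suc w (pos ∘ F.suc) refl)

zero∷≢map-suc : ∀ {v : Vec (Fin (suc n)) m} (w : Vec (Fin n) (suc m)) → F.zero ∷ v ≢ V.map F.suc w
zero∷≢map-suc (_ ∷ _) ()

Increasing-unsuc : ∀ {v : Vec (Fin (suc n)) m} .pos → Increasing v → Increasing (unsuc v pos)
Increasing-unsuc {v = v} pos inc = increasing λ i j i<j →
  s<s⁻¹ (subst₂ _<_ (cong toℕ (lookup-unsuc v pos i)) (cong toℕ (lookup-unsuc v pos j)) (lookup-< inc i j i<j))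

record Fits {A B : Set} (R : A → B → Set) (xs : List A) (ys : List B)
            (v : Vec (Fin (length ys)) (length xs)) : Set where
  constructor fits
  field lookup-R : ∀ i → R (L.lookup xs i) (L.lookup ys (V.lookup v i))
open Fits

module _ {A B : Set} {R : A → B → Set} {xs : List A} {y : B} {ys : List B} where

  Fits-map-suc : {v : Vec (Fin (length ys)) (length xs)} → Fits R xs ys v → Fits R xs (y ∷ ys) (V.map F.suc v)
  Fits-map-suc {v} fv = fits λ i →
    subst (R (L.lookup xs i) ∘ L.lookup (y ∷ ys)) (sym (lookup-map i F.suc v)) (lookup-R fv i)

  Fits-unsuc : ∀ {v : Vec (Fin (suc (length ys))) (length xs)} .pos → Fits R xs (y ∷ ys) v → Fits R xs ys (unsuc v pos)
  Fits-unsuc {v} pos fv = fits λ i →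
    subst (R (L.lookup xs i) ∘ L.lookup (y ∷ ys)) (lookup-unsuc v pos i) (lookup-R fv i)

  module _ {f : Vec (Fin (suc (length ys))) (length xs)} where

    Fits-∷⁺ : All (λ x → R x y) xs → (∀ i j → V.lookup f i ≡ F.suc j → R (L.lookup xs i) (L.lookup ys j)) →
              Fits R xs (y ∷ ys) f
    Fits-∷⁺ R-y fit = fits at
      where
      at : ∀ i → R (L.lookup xs i) (L.lookup (y ∷ ys) (V.lookup f i))
      at i with V.lookup f i in eq
      ... | zero  = All.lookup R-y (∈-lookup i)
      ... | suc j = fit i j eq

    Fits-∷⁻ : Fits R xs (y ∷ ys) f → ∀ i j → V.lookup f i ≡ F.suc j → R (L.lookup xs i) (L.lookup ys j)
    Fits-∷⁻ fv i j eq = subst (R (L.lookup xs i) ∘ L.lookup (y ∷ ys)) eq (lookup-R fv i)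

All-resp-Sublist : ∀ {A B : Set} {R : A → B → Set} {P : A → Set} {Q : B → Set} {xs ys} →
                   (∀ {x y} → R x y → Q y → P x) → Sublist R xs ys → All Q ys → All P xs
All-resp-Sublist R⇒ []       []       = []
All-resp-Sublist R⇒ (y ∷ʳ θ) (_ ∷ qs) = All-resp-Sublist R⇒ θ qs
All-resp-Sublist R⇒ (r ∷ θ)  (q ∷ qs) = R⇒ r q ∷ All-resp-Sublist R⇒ θ qs

module _ {A B : Set} {R : A → B → Set} where

  index : ∀ {xs ys} → Sublist R xs ys → Vec (Fin (length ys)) (length xs)
  index []       = []
  index (y ∷ʳ θ) = V.map F.suc (index θ)
  index (r ∷ θ)  = F.zero ∷ V.map F.suc (index θ)

  index-increasing : ∀ {xs ys} (θ : Sublist R xs ys) → Increasing (index θ)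
  index-increasing []       = increasing λ ()
  index-increasing (y ∷ʳ θ) = Increasing-map-suc (index-increasing θ)
  index-increasing (r ∷ θ)  = Increasing-zero∷ (index-increasing θ)

  index-fits : ∀ {xs ys} (θ : Sublist R xs ys) → Fits R xs ys (index θ)
  index-fits []       = fits λ ()
  index-fits (y ∷ʳ θ) = Fits-map-suc (index-fits θ)
  index-fits (r ∷ θ)  = fits λ where
    zero    → r
    (suc i) → lookup-R (Fits-map-suc (index-fits θ)) i

  module _ (R? : Decidable R) where

    fromIndex : ∀ xs ys (v : Vec (Fin (length ys)) (length xs)) → .(Increasing v) → .(Fits R xs ys v) →
                Sublist R xs ys
    fromIndex []       []       []          _   _  = []
    fromIndex []       (y ∷ ys) []          _   _  = y ∷ʳ fromIndex [] ys [] (increasing λ ()) (fits λ ())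
    fromIndex (x ∷ xs) []       (() ∷ _)
    fromIndex (x ∷ xs) (y ∷ ys) (zero ∷ v)  inc fv =
      recompute (R? x y) (lookup-R fv zero) ∷
      fromIndex xs ys (unsuc v (Increasing-head inc))
                (Increasing-unsuc (Increasing-head inc) (Increasing-tail inc))
                (Fits-unsuc {v = v} (Increasing-head inc) (fits (lookup-R fv ∘ F.suc)))
    fromIndex (x ∷ xs) (y ∷ ys) (suc z ∷ v) inc fv =
      y ∷ʳ fromIndex (x ∷ xs) ys (unsuc (suc z ∷ v) (Increasing-suc∷-positive inc))
                     (Increasing-unsuc (Increasing-suc∷-positive inc) inc)
                     (Fits-unsuc (Increasing-suc∷-positive inc) fv)

    index-fromIndex : ∀ xs ys v .{inc fv} → index (fromIndex xs ys v inc fv) ≡ v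
    index-fromIndex []       []       []                = refl
    index-fromIndex []       (y ∷ ys) []                = cong (V.map F.suc) (index-fromIndex [] ys [])
    index-fromIndex (x ∷ xs) (y ∷ ys) (zero ∷ v)  {inc} =
      cong (F.zero ∷_) (trans (cong (V.map F.suc) (index-fromIndex xs ys _)) (map-suc-unsuc v (Increasing-head inc)))
    index-fromIndex (x ∷ xs) (y ∷ ys) (suc z ∷ v) {inc} =
      trans (cong (V.map F.suc) (index-fromIndex (x ∷ xs) ys _))
            (map-suc-unsuc (suc z ∷ v) (Increasing-suc∷-positive inc))

    module _ (R-irr : Irrelevant R) where

      fromIndex-[] : ∀ {ys} (θ : Sublist R [] ys) → ∀ .{inc fv} → fromIndex [] ys [] inc fv ≡ θ
      fromIndex-[] []       = refl
      fromIndex-[] (y ∷ʳ θ) = cong (y ∷ʳ_) (fromIndex-[] θ)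

      fromIndex-index : ∀ {xs ys} (θ : Sublist R xs ys) v → v ≡ index θ → ∀ .{inc fv} → fromIndex xs ys v inc fv ≡ θ
      fromIndex-index {[]}    θ        []          _  = fromIndex-[] θ
      fromIndex-index {_ ∷ _} (y ∷ʳ θ) (zero ∷ v)  eq = ⊥-elim (zero∷≢map-suc (index θ) eq)
      fromIndex-index {_ ∷ _} (y ∷ʳ θ) (suc z ∷ v) eq {inc} =
        cong (y ∷ʳ_) (fromIndex-index θ _ (unsuc-map-suc (index θ) (Increasing-suc∷-positive inc) eq))
      fromIndex-index (r ∷ θ) (zero ∷ v) eq {inc} =
        cong₂ _∷_ (R-irr _ r) (fromIndex-index θ _ (unsuc-map-suc (index θ) (Increasing-head inc) (∷-injectiveʳ eq)))

-- Walking along a sublist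

Thinning : Set
Thinning = Σ (List ℕ) λ α → Σ (List ℕ) λ β → Sublist _≤_ α β

Below : ℕ × ℕ → Set
Below (i , j) = j ≤ i

walk : ∀ {α β} → Sublist _≤_ α β → List (ℕ × ℕ)
walk []                        = []
walk (y ∷ʳ θ)                  = (y , y) ∷ walk θ
walk (_∷_ {x = a} {y = y} _ θ) = (y , y ∸ a) ∷ walk θ

map-proj₁-walk : ∀ {α β} (θ : Sublist _≤_ α β) → map proj₁ (walk θ) ≡ β
map-proj₁-walk []                = refl
map-proj₁-walk (y ∷ʳ θ)          = cong (y ∷_) (map-proj₁-walk θ)
map-proj₁-walk (_∷_ {y = y} _ θ) = cong (y ∷_) (map-proj₁-walk θ)

walk-below : ∀ {α β} (θ : Sublist _≤_ α β) → All Below (walk θ)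
walk-below []                        = []
walk-below (y ∷ʳ θ)                  = ≤-refl ∷ walk-below θ
walk-below (_∷_ {x = a} {y = y} _ θ) = m∸n≤m y a ∷ walk-below θ

zDegree-walk : ∀ {α β} (θ : Sublist _≤_ α β) → zDegree (walk θ) + sum α ≡ sum β
zDegree-walk []                = refl
zDegree-walk {α} (y ∷ʳ θ)      = trans (+-assoc y (zDegree (walk θ)) (sum α)) (cong (y +_) (zDegree-walk θ))
zDegree-walk (_∷_ {x = a} {xs = α} {y = y} a≤y θ) =
  trans (interchange (y ∸ a) (zDegree (walk θ)) a (sum α)) (cong₂ _+_ (m∸n+n≡m a≤y) (zDegree-walk θ))

unwalk : (l : List (ℕ × ℕ)) → Σ (List ℕ) λ α → Sublist _≤_ α (map proj₁ l)
unwalk [] = [] , []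
unwalk ((i , j) ∷ l) with i ≟ j
... | yes _ = proj₁ (unwalk l) , i ∷ʳ proj₂ (unwalk l)
... | no  _ = i ∸ j ∷ proj₁ (unwalk l) , m∸n≤m i j ∷ proj₂ (unwalk l)

thinning : List (ℕ × ℕ) → Thinning
thinning l = proj₁ (unwalk l) , map proj₁ l , proj₂ (unwalk l)

walk-unwalk : .(All Below l) → walk (proj₂ (unwalk l)) ≡ l
walk-unwalk {[]}          _  = refl
walk-unwalk {(i , j) ∷ l} bs with i ≟ j
... | yes refl = cong ((i , i) ∷_) (walk-unwalk (All.tail bs))
... | no  _    = cong₂ _∷_ (cong (i ,_) (m∸[m∸n]≡n (recompute (j ≤? i) (All.head bs)))) (walk-unwalk (All.tail bs))

unwalk-positive : All Below l → All (1 ≤_) (proj₁ (unwalk l))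
unwalk-positive {[]}          []         = []
unwalk-positive {(i , j) ∷ l} (j≤i ∷ bs) with i ≟ j
... | yes _   = unwalk-positive bs
... | no  i≢j = m<n⇒0<n∸m (≤∧≢⇒< j≤i (i≢j ∘ sym)) ∷ unwalk-positive bs

takeₜ : ∀ {a y} → a ≤ y → Thinning → Thinning
takeₜ {a} {y} r (α , β , θ) = a ∷ α , y ∷ β , r ∷ θ

takeₜ-cong : ∀ {a a' y t t'} (r : a ≤ y) (r' : a' ≤ y) → a ≡ a' → t ≡ t' → takeₜ r t ≡ takeₜ r' t'
takeₜ-cong {t = t} r r' refl refl = cong (λ r → takeₜ r t) (≤-irrelevant r r')

unwalk-walk : ∀ {α β} → .(All (1 ≤_) α) → (θ : Sublist _≤_ α β) → thinning (walk θ) ≡ (α , β , θ)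
unwalk-walk _ [] = refl
unwalk-walk pos (y ∷ʳ θ) with y ≟ y
... | yes _  = cong (λ (α , β , θ) → α , y ∷ β , y ∷ʳ θ) (unwalk-walk pos θ)
... | no y≢y = ⊥-elim (y≢y refl)
unwalk-walk pos (_∷_ {x = a} {y = y} a≤y θ) with y ≟ y ∸ a
... | yes y≡y∸a = ⊥-elim-irr (<-irrefl (sym y≡y∸a) (∸-monoʳ-< (All.head pos) a≤y))
... | no _      = takeₜ-cong _ a≤y (m∸[m∸n]≡n a≤y) (unwalk-walk (All.tail pos) θ)

-- Cards as sublists

-- f i = 0 becomes: α_i lands on the virtual first part k. The capacity bound on α is then implied by θ.
record Embedding (b k : ℕ) : Set where
  constructor embedding
  field
    α β : List ℕ
    θ : Sublist _≤_ α (k ∷ β)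
    .α-pos : All (1 ≤_) α
    .β-pos : All (1 ≤_) β
    .α-size : sum α ≡ b
    .β-size : sum β ≡ b
    .β-cap : All (_≤ k) β

Card-≡ : {c d : Card b k} →
         _≡_ {A = Σ (List ℕ) λ α → Σ (List ℕ) λ β → Vec (Fin (suc (length β))) (length α)}
             (Card.α c , Card.β c , Card.f c) (Card.α d , Card.β d , Card.f d) → c ≡ d
Card-≡ refl = refl

Embedding-≡ : {e e' : Embedding b k} →
              _≡_ {A = Thinning} (Embedding.α e , k ∷ Embedding.β e , Embedding.θ e)
                                 (Embedding.α e' , k ∷ Embedding.β e' , Embedding.θ e') → e ≡ e'
Embedding-≡ refl = refl

Card↔Embedding : Card b k ↔ Embedding b k
Card↔Embedding {b} {k} = mk↔ₛ′ toEmbedding fromEmbedding to∘from from∘to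
  where
  toEmbedding : Card b k → Embedding b k
  toEmbedding record { α = α ; β = β ; f = f ; α-pos = α-pos ; β-pos = β-pos ; α-size = α-size
                     ; β-size = β-size ; α-cap = α-cap ; β-cap = β-cap ; f-incr = f-incr ; f-fit = f-fit } =
    embedding α β (fromIndex _≤?_ α (k ∷ β) f (increasing f-incr) (Fits-∷⁺ α-cap f-fit))
              α-pos β-pos α-size β-size β-cap

  fromEmbedding : Embedding b k → Card b k
  fromEmbedding (embedding α β θ α-pos β-pos α-size β-size β-cap) = record
    { α = α ; β = β ; f = index θ
    ; α-pos = α-pos ; β-pos = β-pos ; α-size = α-size ; β-size = β-size
    ; α-cap = All-resp-Sublist ≤-trans θ (≤-refl ∷ β-cap) ; β-cap = β-cap
    ; f-incr = lookup-< (index-increasing θ) ; f-fit = Fits-∷⁻ (index-fits θ) }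

  to∘from : ∀ e → toEmbedding (fromEmbedding e) ≡ e
  to∘from (embedding _ _ θ _ _ _ _ _) =
    Embedding-≡ (cong (λ θ → _ , _ , θ) (fromIndex-index _≤?_ ≤-irrelevant θ _ refl))

  from∘to : ∀ c → fromEmbedding (toEmbedding c) ≡ c
  from∘to record { α = α ; β = β ; f = f } =
    Card-≡ (cong (λ f → _ , _ , f) (index-fromIndex _≤?_ α (k ∷ β) f))

withVirtual : ℕ → List (ℕ × ℕ) → List (ℕ × ℕ)
withVirtual k l = (k , k ∸ zDegree l) ∷ l

withVirtual-drop : ∀ {β} L → map proj₁ L ≡ k ∷ β → zDegree L ≡ k → withVirtual k (drop 1 L) ≡ L
withVirtual-drop ((i , j) ∷ l) refl j+z≡k =
  cong (λ j → (i , j) ∷ l) (sym (proj₂ (+≡⇒≤×∸ (trans (+-comm (zDegree l) j) j+z≡k))))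

zDegree-walk-virtual : ∀ {α β} (θ : Sublist _≤_ α (k ∷ β)) → .(sum α ≡ sum β) → zDegree (walk θ) ≡ k
zDegree-walk-virtual {k} {α} θ sα≡sβ = recompute (zDegree (walk θ) ≟ k)
  (+-cancelʳ-≡ (sum α) _ _ (trans (zDegree-walk θ) (cong (k +_) (sym sα≡sβ))))

map-proj₁-drop-walk : ∀ {α β} (θ : Sublist _≤_ α (k ∷ β)) → map proj₁ (drop 1 (walk θ)) ≡ β
map-proj₁-drop-walk θ = trans (sym (drop-map 1 (walk θ))) (cong (drop 1) (map-proj₁-walk θ))

zDegree-drop : ∀ l → zDegree (drop 1 l) ≤ zDegree l
zDegree-drop []            = ≤-refl
zDegree-drop ((_ , j) ∷ l) = m≤n+m (zDegree l) j

All-Monomial : All (1 ≤_) (map proj₁ l) → All (_≤ k) (map proj₁ l) → All Below l → All (Monomial k) l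
All-Monomial {[]}    []        []        []       = []
All-Monomial {_ ∷ _} (p ∷ pos) (c ∷ cap) (d ∷ ds) = (p , c , d) ∷ All-Monomial pos cap ds

walk-MonomialList : ∀ {α β} (θ : Sublist _≤_ α (k ∷ β)) → All (1 ≤_) β → All (_≤ k) β →
                    sum α ≡ b → sum β ≡ b → MonomialList k b (drop 1 (walk θ))
walk-MonomialList {k} {b} {β = β} θ β-pos β-cap α-size β-size =
  (All-Monomial (subst (All (1 ≤_)) β≡ β-pos) (subst (All (_≤ k)) β≡ β-cap) (drop⁺ 1 (walk-below θ)) ,
   trans (cong sum (map-proj₁-drop-walk θ)) β-size) ,
  subst (zDegree (drop 1 (walk θ)) ≤_) (zDegree-walk-virtual θ (trans α-size (sym β-size))) (zDegree-drop (walk θ))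
  where
  β≡ : β ≡ map proj₁ (drop 1 (walk θ))
  β≡ = sym (map-proj₁-drop-walk θ)

module _ (ml : MonomialList k b l) where

  withVirtual-below : All Below (withVirtual k l)
  withVirtual-below = m∸n≤m k (zDegree l) ∷ All.map (proj₂ ∘ proj₂) (proj₁ (proj₁ ml))

  unwalk-withVirtual-size : sum (proj₁ (unwalk (withVirtual k l))) ≡ b
  unwalk-withVirtual-size = +-cancelˡ-≡ k _ _ (begin
    k + sum α                          ≡⟨ cong (_+ sum α) (sym (m∸n+n≡m (proj₂ ml))) ⟩
    zDegree (withVirtual k l) + sum α  ≡⟨ cong (λ L → zDegree L + sum α) (sym (walk-unwalk withVirtual-below)) ⟩
    zDegree (walk θ) + sum α           ≡⟨ zDegree-walk θ ⟩
    k + xDegree l                      ≡⟨ cong (k +_) (proj₂ (proj₁ ml)) ⟩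
    k + b                              ∎)
    where
    open ≡-Reasoning
    α : List ℕ
    α = proj₁ (unwalk (withVirtual k l))
    θ : Sublist _≤_ α (k ∷ map proj₁ l)
    θ = proj₂ (unwalk (withVirtual k l))

Embedding↔MonomialLists : Embedding b k ↔ MonomialLists k b
Embedding↔MonomialLists {b} {k} = mk↔ₛ′ toLists fromLists to∘from from∘to
  where
  toLists : Embedding b k → MonomialLists k b
  toLists (embedding α β θ _ β-pos α-size β-size β-cap) =
    drop 1 (walk θ) , [ walk-MonomialList θ β-pos β-cap α-size β-size ]

  fromLists : MonomialLists k b → Embedding b k
  fromLists (l , [ ml ]) =
    embedding _ (map proj₁ l) (proj₂ (unwalk (withVirtual k l)))
              (unwalk-positive (withVirtual-below ml)) (map⁺ (All.map proj₁ (proj₁ (proj₁ ml))))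
              (unwalk-withVirtual-size ml) (proj₂ (proj₁ ml)) (map⁺ (All.map (proj₁ ∘ proj₂) (proj₁ (proj₁ ml))))

  to∘from : ∀ ls → toLists (fromLists ls) ≡ ls
  to∘from (l , [ ml ]) = value-injective (cong (drop 1) (walk-unwalk (withVirtual-below ml)))

  from∘to : ∀ e → fromLists (toLists e) ≡ e
  from∘to (embedding α β θ α-pos _ α-size β-size _) = Embedding-≡ (begin
    thinning (withVirtual k (drop 1 (walk θ)))
      ≡⟨ cong thinning (withVirtual-drop (walk θ) (map-proj₁-walk θ) (zDegree-walk-virtual θ (trans α-size (sym β-size)))) ⟩
    thinning (walk θ)
      ≡⟨ unwalk-walk α-pos θ ⟩
    (α , k ∷ β , θ) ∎)
    where open ≡-Reasoning

proposition3p3 : (k : ℕ) → 1 ≤ k → (b : ℕ) → Card b k ↔ Fin (rhsCoeff k b)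
proposition3p3 k _ b = begin
  Card b k           ↔⟨ Card↔Embedding ⟩
  Embedding b k      ↔⟨ Embedding↔MonomialLists ⟩
  MonomialLists k b  ↔⟨ Fin-rhsCoeff k b ⟨
  Fin (rhsCoeff k b) ∎
  where open Related.EquationalReasoning
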